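{- Let $k\ge 2$ and let $\nu$ be a partition such that $\nu=\mathrm{pre}_k(\lambda)$ for some partition $\lambda$. If $m_\nu(1)>0$, then $\lambda$ is the unique partition (of any size) with $\mathrm{pre}_k(\lambda)=\nu$.
   Context: A partition $\lambda=(\lambda_1,\ldots,\lambda_\ell)$ is a weakly decreasing finite sequence of positive integers; $\ell$ is its length. For a positive integer $i$, $m_\lambda(i)$ denotes the number of parts of $\lambda$ equal to $i$. For $k\le \ell$, $\mathrm{pre}_k(\lambda)$ is the partition whose parts are the $\binom{\ell}{k}$ products $\lambda_{i_1}\cdots\lambda_{i_k}$ over all $1\le i_1<\cdots<i_k\le \ell$ (with multiplicity, sorted weakly decreasingly), i.e. the summands of $e_k(\lambda_1,\ldots,\lambda_\ell)$. If $\ell<k$, $\mathrm{pre}_k(\lambda)$ is undefined. -}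

module Defs where

open import Data.Nat using (ℕ; zero; suc; _*_; _≤_; _<_; _≥_; _≟_)
open import Data.Nat.Properties using (≤-decTotalOrder; ≤-totalOrder)
open import Data.Nat.ListAction using (product)
open import Data.List using (List; []; _∷_; map; _++_; length; filter)
open import Data.List.Relation.Unary.All using (All)
open import Data.List.Relation.Unary.Sorted.TotalOrder using (Sorted)
open import Data.Product using (_×_)
open import Relation.Binary.PropositionalEquality using (_≡_)
import Relation.Binary.Construct.Flip.EqAndOrd as Flip
import Data.List.Sort.InsertionSort as IS

≥-decTotalOrder = Flip.decTotalOrder ≤-decTotalOrder

IsPartition : List ℕ → Set
IsPartition xs = All (λ x → 1 ≤ x) xs × Sorted (Flip.totalOrder ≤-totalOrder) xs

-- All k-element sub-multisets, indexed by positions i₁ < … < iₖ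
-- (sublists of length k, chosen by position, so multiplicities are kept).
choose : ℕ → List ℕ → List (List ℕ)
choose zero    xs       = [] ∷ []
choose (suc k) []       = []
choose (suc k) (x ∷ xs) = map (x ∷_) (choose k xs) ++ choose (suc k) xs

sortDesc : List ℕ → List ℕ
sortDesc = IS.sort ≥-decTotalOrder

-- pre_k(λ): the binom(ℓ,k) products λ_{i₁}⋯λ_{iₖ}, sorted weakly decreasingly.
-- (Only meaningful when k ≤ length λ; see PreOf.)
pre : ℕ → List ℕ → List ℕ
pre k lam = sortDesc (map product (choose k lam))

PreOf : ℕ → List ℕ → List ℕ → Set
PreOf k lam nu = (k ≤ length lam) × (pre k lam ≡ nu)

mult : List ℕ → ℕ → ℕ
mult nu i = length (filter (i ≟_) nu)

-- A product of k parts equals 1 only if all k parts are 1, so m_ν(1) = C(m_λ(1), k); this is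
-- positive, hence m_λ(1) ≥ k and C(·, k) is strictly increasing there, so ν determines m_λ(1).
-- For v ≥ 2, a product of k parts equal to v either uses only parts < v, or uses exactly one part
-- equal to v and k − 1 parts equal to 1. Hence
--   m_ν(v) = (number of k-products equal to v of the parts < v) + m_λ(v) · C(m_λ(1), k − 1),
-- and since C(m_λ(1), k − 1) > 0, m_λ(v) is determined by ν and the parts of λ below v.
-- Induction on v recovers λ.
module Submission where

open import Defs
open import Data.Nat using (ℕ; zero; suc; _+_; _*_; _≤_; _<_; _≤′_; ≤′-refl; ≤′-step; _≤?_; _≟_; z≤n; s≤s; >-nonZero)
open import Data.Nat.Properties
open import Data.Nat.Combinatorics using (_C_; nCk+nC[k+1]≡[n+1]C[k+1]; k>n⇒nCk≡0)
open import Data.Nat.ListAction using (product)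
open import Data.List using (List; []; _∷_; [_]; map; _++_; length; filter; replicate)
open import Data.List.Properties
  using (map-++; map-cong; map-∘; length-++; filter-++; filter-accept; filter-reject; filter-all; filter-none)
open import Data.List.Relation.Unary.All as All using (All; []; _∷_)
import Data.List.Relation.Unary.All.Properties as All
import Data.List.Relation.Unary.Linked as Linked
open import Data.List.Relation.Unary.Linked.Properties using (Linked⇒All)
open import Data.List.Relation.Unary.Sorted.TotalOrder using (Sorted)
open import Data.List.Relation.Binary.Permutation.Propositional.Properties using (filter-↭; ↭-length)
open import Data.List.Extrema.Nat using (max; xs≤max)
import Data.List.Sort.InsertionSort.Properties as InsertionSort
open import Data.Product using (_,_)
open import Data.Empty using (⊥-elim)
open import Relation.Nullary using (¬_; yes; no)
open import Relation.Binary using (tri<; tri≈; tri>)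
open import Relation.Binary.PropositionalEquality using (_≡_; refl; sym; trans; cong; cong₂; subst; ≢-sym; module ≡-Reasoning)
import Relation.Binary.Construct.Flip.EqAndOrd as Flip

Decreasing : List ℕ → Set
Decreasing = Sorted (Flip.totalOrder ≤-totalOrder)

atMost : ℕ → List ℕ → List ℕ
atMost v = filter (_≤? v)

-- a · (product of the parts at positions i₁ < … < iⱼ), in the order of choose j.
scaledProducts : ℕ → ℕ → List ℕ → List ℕ
scaledProducts a zero    xs       = a ∷ []
scaledProducts a (suc j) []       = []
scaledProducts a (suc j) (x ∷ xs) = scaledProducts (a * x) j xs ++ scaledProducts a (suc j) xs

open ≡-Reasoning

C-pos : ∀ {n k} → k ≤ n → 0 < n C k
C-pos {n}     {zero}  _         = s≤s z≤n
C-pos {suc n} {suc k} (s≤s k≤n) =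
  ≤-trans (C-pos k≤n) (≤-trans (m≤m+n _ _) (≤-reflexive (nCk+nC[k+1]≡[n+1]C[k+1] n k)))

C-pos⇒≤ : ∀ {n k} → 0 < n C k → k ≤ n
C-pos⇒≤ {n} {k} pos with k ≤? n
... | yes k≤n = k≤n
... | no  k≰n = ⊥-elim (<-irrefl (sym (k>n⇒nCk≡0 (≰⇒> k≰n))) pos)

C-≤-suc : ∀ n k → n C k ≤ suc n C k
C-≤-suc n zero    = ≤-refl
C-≤-suc n (suc k) = ≤-trans (m≤n+m _ _) (≤-reflexive (nCk+nC[k+1]≡[n+1]C[k+1] n k))

C-monoˡ-≤ : ∀ k {n m} → n ≤′ m → n C k ≤ m C k
C-monoˡ-≤ k ≤′-refl        = ≤-refl
C-monoˡ-≤ k (≤′-step n≤′m) = ≤-trans (C-monoˡ-≤ k n≤′m) (C-≤-suc _ k)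

C-monoˡ-< : ∀ {n m k} → k ≤ n → n < m → n C suc k < m C suc k
C-monoˡ-< {n} {m} {k} k≤n n<m =
  <-≤-trans (m<n+m _ (C-pos k≤n))
            (≤-trans (≤-reflexive (nCk+nC[k+1]≡[n+1]C[k+1] n k)) (C-monoˡ-≤ (suc k) (≤⇒≤′ n<m)))

C-injectiveˡ : ∀ {n m} k → 0 < n C suc k → n C suc k ≡ m C suc k → n ≡ m
C-injectiveˡ {n} {m} k pos eq with <-cmp n m
... | tri< n<m _ _ = ⊥-elim (<-irrefl eq (C-monoˡ-< (<⇒≤ (C-pos⇒≤ pos)) n<m))
... | tri≈ _ n≡m _ = n≡m
... | tri> _ _ m<n = ⊥-elim (<-irrefl (sym eq) (C-monoˡ-< (<⇒≤ (C-pos⇒≤ (subst (0 <_) eq pos))) m<n))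

mult-++ : ∀ xs ys v → mult (xs ++ ys) v ≡ mult xs v + mult ys v
mult-++ xs ys v = trans (cong length (filter-++ (v ≟_) xs ys)) (length-++ (filter (v ≟_) xs))

mult-none : ∀ {v} xs → All (λ x → ¬ v ≡ x) xs → mult xs v ≡ 0
mult-none {v} xs v∉xs = cong length (filter-none (v ≟_) v∉xs)

mult-replicate-≢ : ∀ {u v} c ys → ¬ u ≡ v → mult (replicate c v ++ ys) u ≡ mult ys u
mult-replicate-≢ zero    ys u≢v = refl
mult-replicate-≢ (suc c) ys u≢v =
  trans (cong length (filter-reject (_ ≟_) u≢v)) (mult-replicate-≢ c ys u≢v)

mult-map-* : ∀ v xs → mult (map (suc v *_) xs) (suc v) ≡ mult xs 1
mult-map-* v []       = refl
mult-map-* v (x ∷ xs) with 1 ≟ x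
... | yes refl = trans (cong length (filter-accept (suc v ≟_) (sym (*-identityʳ (suc v)))))
                       (cong suc (mult-map-* v xs))
... | no 1≢x   = begin
  mult (suc v * x ∷ map (suc v *_) xs) (suc v) ≡⟨ cong length (filter-reject (suc v ≟_) v+1≢[v+1]x) ⟩
  mult (map (suc v *_) xs) (suc v)             ≡⟨ mult-map-* v xs ⟩
  mult xs 1                                    ≡⟨ cong length (filter-reject (1 ≟_) 1≢x) ⟨
  mult (x ∷ xs) 1                              ∎
  where
  v+1≢[v+1]x : ¬ suc v ≡ suc v * x
  v+1≢[v+1]x eq = 1≢x (*-cancelˡ-≡ 1 x (suc v) (trans (*-identityʳ (suc v)) eq))

mult-atMost : ∀ {i v} xs → i ≤ v → mult (atMost v xs) i ≡ mult xs i
mult-atMost             []       i≤v = refl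
mult-atMost {i} {v} (x ∷ xs) i≤v with x ≤? v
... | yes x≤v = begin
  mult (atMost v (x ∷ xs)) i         ≡⟨ cong (λ ys → mult ys i) (filter-accept (_≤? v) x≤v) ⟩
  mult ([ x ] ++ atMost v xs) i      ≡⟨ mult-++ [ x ] (atMost v xs) i ⟩
  mult [ x ] i + mult (atMost v xs) i ≡⟨ cong (mult [ x ] i +_) (mult-atMost xs i≤v) ⟩
  mult [ x ] i + mult xs i           ≡⟨ mult-++ [ x ] xs i ⟨
  mult (x ∷ xs) i                    ∎
... | no x≰v = begin
  mult (atMost v (x ∷ xs)) i ≡⟨ cong (λ ys → mult ys i) (filter-reject (_≤? v) x≰v) ⟩
  mult (atMost v xs) i       ≡⟨ mult-atMost xs i≤v ⟩
  mult xs i                  ≡⟨ cong length (filter-reject (i ≟_) (λ { refl → x≰v i≤v })) ⟨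
  mult (x ∷ xs) i            ∎

mult-pre : ∀ k xs v → mult (pre k xs) v ≡ mult (scaledProducts 1 k xs) v
mult-pre k xs v = begin
  mult (pre k xs) v
    ≡⟨ ↭-length (filter-↭ (v ≟_) (InsertionSort.sort-↭ ≥-decTotalOrder (map product (choose k xs)))) ⟩
  mult (map product (choose k xs)) v
    ≡⟨ cong (λ ys → mult ys v) (map-cong (λ S → sym (*-identityˡ (product S))) (choose k xs)) ⟩
  mult (map (λ S → 1 * product S) (choose k xs)) v
    ≡⟨ cong (λ ys → mult ys v) (map-scaled-product 1 k xs) ⟩
  mult (scaledProducts 1 k xs) v
    ∎
  where
  map-scaled-product : ∀ a j xs → map (λ S → a * product S) (choose j xs) ≡ scaledProducts a j xs
  map-scaled-product a zero    xs       = cong [_] (*-identityʳ a)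
  map-scaled-product a (suc j) []       = refl
  map-scaled-product a (suc j) (x ∷ xs) = begin
    map (λ S → a * product S) (map (x ∷_) (choose j xs) ++ choose (suc j) xs)
      ≡⟨ map-++ _ (map (x ∷_) (choose j xs)) (choose (suc j) xs) ⟩
    map (λ S → a * product S) (map (x ∷_) (choose j xs)) ++ map (λ S → a * product S) (choose (suc j) xs)
      ≡⟨ cong (_++ _) (map-∘ (choose j xs)) ⟨
    map (λ S → a * product (x ∷ S)) (choose j xs) ++ map (λ S → a * product S) (choose (suc j) xs)
      ≡⟨ cong (_++ _) (map-cong (λ S → sym (*-assoc a x (product S))) (choose j xs)) ⟩
    map (λ S → a * x * product S) (choose j xs) ++ map (λ S → a * product S) (choose (suc j) xs)
      ≡⟨ cong₂ _++_ (map-scaled-product (a * x) j xs) (map-scaled-product a (suc j) xs) ⟩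
    scaledProducts (a * x) j xs ++ scaledProducts a (suc j) xs
      ∎

scaledProducts-≥ : ∀ a j xs → All (1 ≤_) xs → All (a ≤_) (scaledProducts a j xs)
scaledProducts-≥ a zero    xs       _            = ≤-refl ∷ []
scaledProducts-≥ a (suc j) []       _            = []
scaledProducts-≥ a (suc j) (x ∷ xs) (1≤x ∷ 1≤xs) = All.++⁺
  (All.map (≤-trans (m≤m*n a x {{>-nonZero 1≤x}})) (scaledProducts-≥ (a * x) j xs 1≤xs))
  (scaledProducts-≥ a (suc j) xs 1≤xs)

scaledProducts-*ˡ : ∀ b a j xs → scaledProducts (b * a) j xs ≡ map (b *_) (scaledProducts a j xs)
scaledProducts-*ˡ b a zero    xs       = refl
scaledProducts-*ˡ b a (suc j) []       = refl
scaledProducts-*ˡ b a (suc j) (x ∷ xs) = begin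
  scaledProducts (b * a * x) j xs ++ scaledProducts (b * a) (suc j) xs
    ≡⟨ cong₂ _++_ (trans (cong (λ c → scaledProducts c j xs) (*-assoc b a x)) (scaledProducts-*ˡ b (a * x) j xs))
                  (scaledProducts-*ˡ b a (suc j) xs) ⟩
  map (b *_) (scaledProducts (a * x) j xs) ++ map (b *_) (scaledProducts a (suc j) xs)
    ≡⟨ map-++ (b *_) (scaledProducts (a * x) j xs) _ ⟨
  map (b *_) (scaledProducts a (suc j) (x ∷ xs))
    ∎

mult-scaledProducts-self : ∀ v j xs →
  mult (scaledProducts (suc v) j xs) (suc v) ≡ mult (scaledProducts 1 j xs) 1
mult-scaledProducts-self v j xs = begin
  mult (scaledProducts (suc v) j xs) (suc v)
    ≡⟨ cong (λ a → mult (scaledProducts a j xs) (suc v)) (*-identityʳ (suc v)) ⟨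
  mult (scaledProducts (suc v * 1) j xs) (suc v)
    ≡⟨ cong (λ ys → mult ys (suc v)) (scaledProducts-*ˡ (suc v) 1 j xs) ⟩
  mult (map (suc v *_) (scaledProducts 1 j xs)) (suc v)
    ≡⟨ mult-map-* v (scaledProducts 1 j xs) ⟩
  mult (scaledProducts 1 j xs) 1
    ∎

mult-scaledProducts-1 : ∀ j xs → All (1 ≤_) xs → mult (scaledProducts 1 j xs) 1 ≡ mult xs 1 C j
mult-scaledProducts-1 zero    xs                 _            = refl
mult-scaledProducts-1 (suc j) []                 _            = refl
mult-scaledProducts-1 (suc j) (1 ∷ xs)           (_ ∷ 1≤xs)   = begin
  mult (scaledProducts 1 j xs ++ scaledProducts 1 (suc j) xs) 1    ≡⟨ mult-++ (scaledProducts 1 j xs) _ 1 ⟩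
  mult (scaledProducts 1 j xs) 1 + mult (scaledProducts 1 (suc j) xs) 1
    ≡⟨ cong₂ _+_ (mult-scaledProducts-1 j xs 1≤xs) (mult-scaledProducts-1 (suc j) xs 1≤xs) ⟩
  mult xs 1 C j + mult xs 1 C suc j                                ≡⟨ nCk+nC[k+1]≡[n+1]C[k+1] (mult xs 1) j ⟩
  suc (mult xs 1) C suc j                                          ∎
mult-scaledProducts-1 (suc j) (suc (suc y) ∷ xs) (_ ∷ 1≤xs)   = begin
  mult (scaledProducts (1 * suc (suc y)) j xs ++ scaledProducts 1 (suc j) xs) 1
    ≡⟨ mult-++ (scaledProducts (1 * suc (suc y)) j xs) _ 1 ⟩
  mult (scaledProducts (1 * suc (suc y)) j xs) 1 + mult (scaledProducts 1 (suc j) xs) 1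
    ≡⟨ cong (_+ _) (mult-none _ (All.map (λ 2+y≤p → <⇒≢ (≤-trans (s≤s (s≤s z≤n)) 2+y≤p))
                                         (scaledProducts-≥ _ j xs 1≤xs))) ⟩
  mult (scaledProducts 1 (suc j) xs) 1
    ≡⟨ mult-scaledProducts-1 (suc j) xs 1≤xs ⟩
  mult xs 1 C suc j
    ∎

-- All parts are ≥ 1, so a product involving a part larger than v exceeds v.
mult-scaledProducts-atMost : ∀ a j v xs → 1 ≤ a → All (1 ≤_) xs →
  mult (scaledProducts a j xs) v ≡ mult (scaledProducts a j (atMost v xs)) v
mult-scaledProducts-atMost a zero    v xs       _   _            = refl
mult-scaledProducts-atMost a (suc j) v []       _   _            = refl
mult-scaledProducts-atMost a (suc j) v (x ∷ xs) 1≤a (1≤x ∷ 1≤xs) with x ≤? v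
... | yes x≤v = begin
  mult (scaledProducts (a * x) j xs ++ scaledProducts a (suc j) xs) v
    ≡⟨ mult-++ (scaledProducts (a * x) j xs) _ v ⟩
  mult (scaledProducts (a * x) j xs) v + mult (scaledProducts a (suc j) xs) v
    ≡⟨ cong₂ _+_ (mult-scaledProducts-atMost (a * x) j v xs (*-mono-≤ 1≤a 1≤x) 1≤xs)
                 (mult-scaledProducts-atMost a (suc j) v xs 1≤a 1≤xs) ⟩
  mult (scaledProducts (a * x) j (atMost v xs)) v + mult (scaledProducts a (suc j) (atMost v xs)) v
    ≡⟨ mult-++ (scaledProducts (a * x) j (atMost v xs)) _ v ⟨
  mult (scaledProducts a (suc j) (x ∷ atMost v xs)) v
    ≡⟨ cong (λ ys → mult (scaledProducts a (suc j) ys) v) (filter-accept (_≤? v) x≤v) ⟨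
  mult (scaledProducts a (suc j) (atMost v (x ∷ xs))) v
    ∎
... | no x≰v = begin
  mult (scaledProducts (a * x) j xs ++ scaledProducts a (suc j) xs) v
    ≡⟨ mult-++ (scaledProducts (a * x) j xs) _ v ⟩
  mult (scaledProducts (a * x) j xs) v + mult (scaledProducts a (suc j) xs) v
    ≡⟨ cong (_+ _) (mult-none _ (All.map (λ ax≤p → <⇒≢ (<-≤-trans v<ax ax≤p))
                                         (scaledProducts-≥ (a * x) j xs 1≤xs))) ⟩
  mult (scaledProducts a (suc j) xs) v
    ≡⟨ mult-scaledProducts-atMost a (suc j) v xs 1≤a 1≤xs ⟩
  mult (scaledProducts a (suc j) (atMost v xs)) v
    ≡⟨ cong (λ ys → mult (scaledProducts a (suc j) ys) v) (filter-reject (_≤? v) x≰v) ⟨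
  mult (scaledProducts a (suc j) (atMost v (x ∷ xs))) v
    ∎
  where
  v<ax : v < a * x
  v<ax = <-≤-trans (≰⇒> x≰v) (m≤n*m x a {{>-nonZero 1≤a}})

-- A product containing the part v ≥ 2 equals v iff all its other parts are 1.
mult-scaledProducts-replicate : ∀ j w c ys → All (1 ≤_) ys →
  mult (scaledProducts 1 (suc j) (replicate c (2 + w) ++ ys)) (2 + w)
    ≡ c * (mult ys 1 C j) + mult (scaledProducts 1 (suc j) ys) (2 + w)
mult-scaledProducts-replicate j w zero    ys _     = refl
mult-scaledProducts-replicate j w (suc c) ys 1≤ys = begin
  mult (scaledProducts (1 * v) j zs ++ scaledProducts 1 (suc j) zs) v
    ≡⟨ mult-++ (scaledProducts (1 * v) j zs) _ v ⟩
  mult (scaledProducts (1 * v) j zs) v + mult (scaledProducts 1 (suc j) zs) v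
    ≡⟨ cong₂ _+_ pairs-with-v (mult-scaledProducts-replicate j w c ys 1≤ys) ⟩
  mult ys 1 C j + (c * (mult ys 1 C j) + mult (scaledProducts 1 (suc j) ys) v)
    ≡⟨ +-assoc (mult ys 1 C j) _ _ ⟨
  suc c * (mult ys 1 C j) + mult (scaledProducts 1 (suc j) ys) v
    ∎
  where
  v = 2 + w
  zs = replicate c v ++ ys
  pairs-with-v : mult (scaledProducts (1 * v) j zs) v ≡ mult ys 1 C j
  pairs-with-v = begin
    mult (scaledProducts (1 * v) j zs) v ≡⟨ cong (λ a → mult (scaledProducts a j zs) v) (*-identityˡ v) ⟩
    mult (scaledProducts v j zs) v       ≡⟨ mult-scaledProducts-self (suc w) j zs ⟩
    mult (scaledProducts 1 j zs) 1       ≡⟨ mult-scaledProducts-1 j zs (All.++⁺ (All.replicate⁺ c (s≤s z≤n)) 1≤ys) ⟩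
    mult zs 1 C j                        ≡⟨ cong (_C j) (mult-replicate-≢ c ys (λ ())) ⟩
    mult ys 1 C j                        ∎

atMost-suc : ∀ w xs → Decreasing xs → atMost (suc w) xs ≡ replicate (mult xs (suc w)) (suc w) ++ atMost w xs
atMost-suc w []       _    = refl
atMost-suc w (x ∷ xs) desc with <-cmp x (suc w)
... | tri< (s≤s x≤w) _ _ = begin
  atMost (suc w) (x ∷ xs)
    ≡⟨ filter-all (_≤? suc w) (All.map m≤n⇒m≤1+n ≤w) ⟩
  x ∷ xs
    ≡⟨ filter-all (_≤? w) ≤w ⟨
  atMost w (x ∷ xs)
    ≡⟨ cong (λ c → replicate c (suc w) ++ atMost w (x ∷ xs))
            (mult-none (x ∷ xs) (All.map (λ y≤w → ≢-sym (<⇒≢ (s≤s y≤w))) ≤w)) ⟨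
  replicate (mult (x ∷ xs) (suc w)) (suc w) ++ atMost w (x ∷ xs)
    ∎
  where
  ≤w : All (_≤ w) (x ∷ xs)
  ≤w = Linked⇒All (λ q p → ≤-trans p q) x≤w desc
... | tri≈ _ refl _ = begin
  atMost (suc w) (suc w ∷ xs)
    ≡⟨ filter-accept (_≤? suc w) ≤-refl ⟩
  suc w ∷ atMost (suc w) xs
    ≡⟨ cong (suc w ∷_) (atMost-suc w xs (Linked.tail desc)) ⟩
  suc w ∷ replicate (mult xs (suc w)) (suc w) ++ atMost w xs
    ≡⟨ cong₂ (λ c ys → replicate c (suc w) ++ ys)
             (cong length (filter-accept (suc w ≟_) refl)) (filter-reject (_≤? w) 1+n≰n) ⟨
  replicate (mult (suc w ∷ xs) (suc w)) (suc w) ++ atMost w (suc w ∷ xs)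
    ∎
... | tri> _ _ w<x = begin
  atMost (suc w) (x ∷ xs)
    ≡⟨ filter-reject (_≤? suc w) (<⇒≱ w<x) ⟩
  atMost (suc w) xs
    ≡⟨ atMost-suc w xs (Linked.tail desc) ⟩
  replicate (mult xs (suc w)) (suc w) ++ atMost w xs
    ≡⟨ cong₂ (λ c ys → replicate c (suc w) ++ ys)
             (cong length (filter-reject (suc w ≟_) (<⇒≢ w<x))) (filter-reject (_≤? w) (<⇒≱ (<⇒≤ w<x))) ⟨
  replicate (mult (x ∷ xs) (suc w)) (suc w) ++ atMost w (x ∷ xs)
    ∎

mult-scaledProducts-split : ∀ j w xs → All (1 ≤_) xs → Decreasing xs →
  mult (scaledProducts 1 (suc j) xs) (2 + w)
    ≡ mult xs (2 + w) * (mult xs 1 C j) + mult (scaledProducts 1 (suc j) (atMost (suc w) xs)) (2 + w)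
mult-scaledProducts-split j w xs 1≤xs desc = begin
  mult (scaledProducts 1 (suc j) xs) v
    ≡⟨ mult-scaledProducts-atMost 1 (suc j) v xs ≤-refl 1≤xs ⟩
  mult (scaledProducts 1 (suc j) (atMost v xs)) v
    ≡⟨ cong (λ ys → mult (scaledProducts 1 (suc j) ys) v) (atMost-suc (suc w) xs desc) ⟩
  mult (scaledProducts 1 (suc j) (replicate (mult xs v) v ++ atMost (suc w) xs)) v
    ≡⟨ mult-scaledProducts-replicate j w (mult xs v) (atMost (suc w) xs) (All.filter⁺ (_≤? suc w) 1≤xs) ⟩
  mult xs v * (mult (atMost (suc w) xs) 1 C j) + mult (scaledProducts 1 (suc j) (atMost (suc w) xs)) v
    ≡⟨ cong (λ m → mult xs v * (m C j) + mult (scaledProducts 1 (suc j) (atMost (suc w) xs)) v)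
            (mult-atMost xs (s≤s z≤n)) ⟩
  mult xs v * (mult xs 1 C j) + mult (scaledProducts 1 (suc j) (atMost (suc w) xs)) v
    ∎
  where
  v = 2 + w

atMost-zero : ∀ {xs} → All (1 ≤_) xs → atMost 0 xs ≡ []
atMost-zero 1≤xs = filter-none (_≤? 0) (All.map (λ 1≤x x≤0 → 1+n≰n (≤-trans 1≤x x≤0)) 1≤xs)

module _ (j : ℕ) {mu lam : List ℕ}
         (1≤mu : All (1 ≤_) mu) (mu-desc : Decreasing mu)
         (1≤lam : All (1 ≤_) lam) (lam-desc : Decreasing lam)
         (same-mult : ∀ v → mult (scaledProducts 1 (suc j) mu) v ≡ mult (scaledProducts 1 (suc j) lam) v)
         (one-occurs : 0 < mult (scaledProducts 1 (suc j) lam) 1)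
         where

  ones-pos : 0 < mult lam 1 C suc j
  ones-pos = subst (0 <_) (mult-scaledProducts-1 (suc j) lam 1≤lam) one-occurs

  ones-agree : mult mu 1 ≡ mult lam 1
  ones-agree = sym (C-injectiveˡ j ones-pos (begin
    mult lam 1 C suc j                        ≡⟨ mult-scaledProducts-1 (suc j) lam 1≤lam ⟨
    mult (scaledProducts 1 (suc j) lam) 1     ≡⟨ same-mult 1 ⟨
    mult (scaledProducts 1 (suc j) mu) 1      ≡⟨ mult-scaledProducts-1 (suc j) mu 1≤mu ⟩
    mult mu 1 C suc j                         ∎))

  mult-agree : ∀ w → atMost w mu ≡ atMost w lam → mult mu (suc w) ≡ mult lam (suc w)
  mult-agree zero    _  = ones-agree
  mult-agree (suc w) eq =
    *-cancelʳ-≡ _ _ (mult lam 1 C j) {{>-nonZero (C-pos {k = j} (<⇒≤ (C-pos⇒≤ ones-pos)))}}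
    (+-cancelʳ-≡ _ _ _ (begin
      mult mu v * (mult lam 1 C j) + mult (scaledProducts 1 (suc j) (atMost (suc w) lam)) v
        ≡⟨ cong₂ (λ m ys → mult mu v * (m C j) + mult (scaledProducts 1 (suc j) ys) v) ones-agree eq ⟨
      mult mu v * (mult mu 1 C j) + mult (scaledProducts 1 (suc j) (atMost (suc w) mu)) v
        ≡⟨ mult-scaledProducts-split j w mu 1≤mu mu-desc ⟨
      mult (scaledProducts 1 (suc j) mu) v
        ≡⟨ same-mult v ⟩
      mult (scaledProducts 1 (suc j) lam) v
        ≡⟨ mult-scaledProducts-split j w lam 1≤lam lam-desc ⟩
      mult lam v * (mult lam 1 C j) + mult (scaledProducts 1 (suc j) (atMost (suc w) lam)) v
        ∎))
    where
    v = 2 + w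

  atMost-agree : ∀ v → atMost v mu ≡ atMost v lam
  atMost-agree zero    = trans (atMost-zero 1≤mu) (sym (atMost-zero 1≤lam))
  atMost-agree (suc w) = begin
    atMost (suc w) mu                                      ≡⟨ atMost-suc w mu mu-desc ⟩
    replicate (mult mu (suc w)) (suc w) ++ atMost w mu     ≡⟨ cong₂ (λ c ys → replicate c (suc w) ++ ys) (mult-agree w ih) ih ⟩
    replicate (mult lam (suc w)) (suc w) ++ atMost w lam   ≡⟨ atMost-suc w lam lam-desc ⟨
    atMost (suc w) lam                                     ∎
    where
    ih = atMost-agree w

  scaledProducts-injective : mu ≡ lam
  scaledProducts-injective = begin
    mu                ≡⟨ filter-all (_≤? bound) (All.++⁻ˡ mu ≤bound) ⟨
    atMost bound mu   ≡⟨ atMost-agree bound ⟩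
    atMost bound lam  ≡⟨ filter-all (_≤? bound) (All.++⁻ʳ mu ≤bound) ⟩
    lam               ∎
    where
    bound = max 0 (mu ++ lam)
    ≤bound = xs≤max 0 (mu ++ lam)

pre-injective : ∀ j {mu lam} → IsPartition mu → IsPartition lam →
  pre (suc j) mu ≡ pre (suc j) lam → 0 < mult (pre (suc j) lam) 1 → mu ≡ lam
pre-injective j {mu} {lam} (1≤mu , mu-desc) (1≤lam , lam-desc) eq one-occurs =
  scaledProducts-injective j 1≤mu mu-desc 1≤lam lam-desc same-mult
    (subst (0 <_) (mult-pre (suc j) lam 1) one-occurs)
  where
  same-mult : ∀ v → mult (scaledProducts 1 (suc j) mu) v ≡ mult (scaledProducts 1 (suc j) lam) v
  same-mult v = begin
    mult (scaledProducts 1 (suc j) mu) v   ≡⟨ mult-pre (suc j) mu v ⟨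
    mult (pre (suc j) mu) v                ≡⟨ cong (λ ν → mult ν v) eq ⟩
    mult (pre (suc j) lam) v               ≡⟨ mult-pre (suc j) lam v ⟩
    mult (scaledProducts 1 (suc j) lam) v  ∎

lemma2p4 : (k : ℕ) → 2 ≤ k → (nu lam : List ℕ) →
             IsPartition nu → IsPartition lam → PreOf k lam nu →
             0 < mult nu 1 →
             (mu : List ℕ) → IsPartition mu → PreOf k mu nu → mu ≡ lam
lemma2p4 zero    ()
lemma2p4 (suc j) _ nu lam _ lam-partition (_ , lam↦nu) one-occurs mu mu-partition (_ , mu↦nu) =
  pre-injective j mu-partition lam-partition (trans mu↦nu (sym lam↦nu))
    (subst (λ ν → 0 < mult ν 1) (sym lam↦nu) one-occurs)
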